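{- Let $n,r,e,R$ be integers with $e\ge 2$, and for integers $R,e$ let $T_r(n,R,e):=f_r(n,er-R,e)$. Then for every integer $l$ with $1\le l\le r$, $$T_r(n,R,e)\le T_r(n,R-l,e-1)+\binom{n}{l}\Big/\binom{r}{l}.$$
   Context: For integers $r,v,e$, an $r$-uniform hypergraph is called $\mathcal{G}_r(v,e)$-free if the union of any $e$ distinct edges has at least $v+1$ vertices. $f_r(n,v,e)$ denotes the maximum number of edges in a $\mathcal{G}_r(v,e)$-free $r$-uniform hypergraph on $n$ vertices. -}

module Defs where

open import Data.Nat using (ℕ; _≤_; _*_; _+_; _∸_)
open import Data.Integer as ℤ using (ℤ; +_)
open import Data.Fin using (Fin)
open import Data.Fin.Subset using (Subset; ⋃; ∣_∣)
open import Data.List using (List; length; lookup; tabulate)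
open import Data.List.Relation.Unary.All using (All)
open import Data.List.Relation.Unary.Unique.Propositional using (Unique)
open import Data.Product using (Σ; _×_)
open import Function.Definitions using (Injective)
open import Relation.Binary.PropositionalEquality using (_≡_)

record Hypergraph (r n : ℕ) : Set where
  field
    edges   : List (Subset n)
    unique  : Unique edges
    uniform : All (λ s → ∣ s ∣ ≡ r) edges
open Hypergraph public

numEdges : ∀ {r n} → Hypergraph r n → ℕ
numEdges H = length (edges H)

-- G_r(v,e)-free: the union of any e distinct edges has at least v+1
-- vertices.  (v is an integer; e distinct edges = injective choice of
-- e edge positions in the duplicate-free edge list.)
GFree : ∀ {r n} → ℤ → ℕ → Hypergraph r n → Set
GFree {r} {n} v e H =
  (idx : Fin e → Fin (length (edges H))) →
  Injective _≡_ _≡_ idx →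
  v ℤ.+ ℤ.+ 1 ℤ.≤ + ∣ ⋃ (tabulate (λ i → lookup (edges H) (idx i))) ∣

IsF : (r n : ℕ) → ℤ → ℕ → ℕ → Set
IsF r n v e m =
  Σ (Hypergraph r n) (λ H → GFree v e H × numEdges H ≡ m)
  × ((H : Hypergraph r n) → GFree v e H → numEdges H ≤ m)

IsT : (r n : ℕ) → ℤ → ℕ → ℕ → Set
IsT r n R e m = IsF r n (+ (e * r) ℤ.- R) e m

module Submission where

-- Let H be a G_r(er-R, e)-free r-uniform hypergraph with
-- T_r(n,R,e) edges, and put v′ = (e-1)r - (R-l).  Peel edges off H one at a
-- time: as long as the kept edges are not G_r(v′, e-1)-free, some e-1 kept
-- edges F₀,…,F_{e-2} span at most v′ vertices; remove F₀.  Any edge q that is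
-- no longer kept forms with F₀,…,F_{e-2} a family of e distinct edges of H,
-- which spans at least er-R+1 vertices; inclusion–exclusion then forces
-- |q ∩ (F₀ ∪ … ∪ F_{e-2})| < l, so |F₀ ∩ q| < l.  Hence the removed edges
-- pairwise share fewer than l vertices, so no l-set lies in two of them and
-- (#removed)·C(r,l) ≤ C(n,l), while the kept edges are G_r(v′,e-1)-free and
-- number at most T_r(n,R-l,e-1).

open import Defs
open import Data.Nat using (ℕ; _≤_; _*_; _+_; _∸_)
open import Data.Nat.Combinatorics using (_C_)
open import Data.Integer as ℤ using (ℤ; +_)

open import Data.Nat as ℕ using (suc; zero; _<_; z≤n; s≤s)
open import Data.Nat.Properties
open import Data.Nat.Combinatorics using (nCk+nC[k+1]≡[n+1]C[k+1])
open import Data.Nat.ListAction using (sum)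
open import Data.Nat.Solver using (module +-*-Solver)
import Data.Integer.Properties as ℤP
import Data.Integer.Solver as ℤSolver
open import Data.Bool using (true; false)
open import Data.Vec using ([]; _∷_; tail)
import Data.Vec.Functional as Vector
open import Data.Fin using (Fin; zero; suc)
open import Data.Fin.Subset using (Subset; ∣_∣; _∩_; _∪_; ⋃; _⊆_)
open import Data.Fin.Subset.Properties using (p⊆q⇒∣p∣≤∣q∣; x∈p∩q⁺; x∈p∩q⁻; p⊆p∪q)
open import Data.List using (List; []; _∷_; map; length; lookup; tabulate; removeAt)
open import Data.List.Properties using (tabulate-cong; length-removeAt′)
open import Data.List.Relation.Unary.All using (All; []; _∷_)
import Data.List.Relation.Unary.All as All
open import Data.List.Relation.Unary.Any using (here; there; index)
open import Data.List.Relation.Unary.Any.Properties using (lookup-index)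
open import Data.List.Relation.Unary.AllPairs using (AllPairs; []; _∷_)
import Data.List.Relation.Unary.AllPairs as AllPairs
import Data.List.Relation.Unary.AllPairs.Properties as AllPairsP
open import Data.List.Relation.Unary.Unique.Propositional using (Unique)
open import Data.List.Membership.Propositional using (_∈_; _∉_)
open import Data.List.Membership.Propositional.Properties using (∈-lookup)
open import Data.Product using (Σ; _×_; _,_)
open import Data.Sum using (_⊎_; inj₁; inj₂)
open import Data.Empty using (⊥; ⊥-elim)
open import Relation.Nullary using (¬_)
open import Relation.Nullary.Negation using (DoubleNegation; ¬¬-map)
open import Relation.Nullary.Decidable using (decidable-stable)
open import Function.Definitions using (Injective)
open import Relation.Binary.PropositionalEquality

inclusion-exclusion : ∀ {n} (p q : Subset n) → ∣ p ∪ q ∣ + ∣ p ∩ q ∣ ≡ ∣ p ∣ + ∣ q ∣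
inclusion-exclusion [] [] = refl
inclusion-exclusion (true ∷ p) (true ∷ q) =
  cong suc (trans (+-suc _ _) (trans (cong suc (inclusion-exclusion p q)) (sym (+-suc _ _))))
inclusion-exclusion (true ∷ p) (false ∷ q) = cong suc (inclusion-exclusion p q)
inclusion-exclusion (false ∷ p) (true ∷ q) =
  trans (cong suc (inclusion-exclusion p q)) (sym (+-suc _ _))
inclusion-exclusion (false ∷ p) (false ∷ q) = inclusion-exclusion p q

∣p∩q∣≤∣q∩[p∪s]∣ : ∀ {n} (p q s : Subset n) → ∣ p ∩ q ∣ ≤ ∣ q ∩ (p ∪ s) ∣
∣p∩q∣≤∣q∩[p∪s]∣ p q s = p⊆q⇒∣p∣≤∣q∣ p∩q⊆q∩[p∪s]
  where
  p∩q⊆q∩[p∪s] : p ∩ q ⊆ q ∩ (p ∪ s)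
  p∩q⊆q∩[p∪s] x∈p∩q with x∈p∩q⁻ p q x∈p∩q
  ... | x∈p , x∈q = x∈p∩q⁺ (x∈q , p⊆p∪q s x∈p)

∣tail∩tail∣≤∣∩∣ : ∀ {n} (p q : Subset (suc n)) → ∣ tail p ∩ tail q ∣ ≤ ∣ p ∩ q ∣
∣tail∩tail∣≤∣∩∣ (true ∷ p) (true ∷ q) = n≤1+n _
∣tail∩tail∣≤∣∩∣ (true ∷ p) (false ∷ q) = ≤-refl
∣tail∩tail∣≤∣∩∣ (false ∷ p) (_ ∷ q) = ≤-refl

-- The packing bound: sets pairwise sharing fewer than l points contain,
-- between them, no l-set twice, so at most C(n,l) l-sets in total.

Sparse : ℕ → ∀ {n} → Subset n → Subset n → Set
Sparse l p q = ∣ p ∩ q ∣ < l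

lSubsets : ℕ → ∀ {n} → List (Subset n) → ℕ
lSubsets l xs = sum (map (λ p → ∣ p ∣ C l) xs)

link₀ : ∀ {n} → List (Subset (suc n)) → List (Subset n)
link₀ [] = []
link₀ ((true ∷ p) ∷ xs) = p ∷ link₀ xs
link₀ ((false ∷ p) ∷ xs) = link₀ xs

-- An (l+1)-subset either avoids vertex 0 or is 0 plus an l-subset of the rest.
lSubsets-split : ∀ {n} l (xs : List (Subset (suc n))) →
  lSubsets (suc l) xs ≡ lSubsets (suc l) (map tail xs) + lSubsets l (link₀ xs)
lSubsets-split l [] = refl
lSubsets-split l ((true ∷ p) ∷ xs)
  rewrite lSubsets-split l xs | sym (nCk+nC[k+1]≡[n+1]C[k+1] ∣ p ∣ l) =
  solve 4 (λ a b c d → (a :+ b) :+ (c :+ d) := (b :+ c) :+ (a :+ d)) refl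
    (∣ p ∣ C l) (∣ p ∣ C suc l) (lSubsets (suc l) (map tail xs)) (lSubsets l (link₀ xs))
  where open +-*-Solver
lSubsets-split l ((false ∷ p) ∷ xs) rewrite lSubsets-split l xs =
  sym (+-assoc (∣ p ∣ C suc l) _ _)

link₀-sparse : ∀ {n} l (xs : List (Subset (suc n))) →
  AllPairs (Sparse (suc l)) xs → AllPairs (Sparse l) (link₀ xs)
link₀-sparse l [] [] = []
link₀-sparse l ((true ∷ p) ∷ xs) (p-sparse ∷ xs-sparse) =
  linked p xs p-sparse ∷ link₀-sparse l xs xs-sparse
  where
  linked : ∀ {n} (p : Subset n) xs → All (Sparse (suc l) (true ∷ p)) xs → All (Sparse l p) (link₀ xs)
  linked p [] [] = []
  linked p ((true ∷ q) ∷ xs) (s≤s pq ∷ rest) = pq ∷ linked p xs rest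
  linked p ((false ∷ q) ∷ xs) (_ ∷ rest) = linked p xs rest
link₀-sparse l ((false ∷ p) ∷ xs) (_ ∷ xs-sparse) = link₀-sparse l xs xs-sparse

tails-sparse : ∀ {n} l (xs : List (Subset (suc n))) →
  AllPairs (Sparse l) xs → AllPairs (Sparse l) (map tail xs)
tails-sparse l xs sparse =
  AllPairsP.map⁺ (AllPairs.map (λ {p} {q} → ≤-<-trans (∣tail∩tail∣≤∣∩∣ p q)) sparse)

lSubsets-empty : ∀ l (xs : List (Subset 0)) → lSubsets (suc l) xs ≡ 0
lSubsets-empty l [] = refl
lSubsets-empty l ([] ∷ xs) = lSubsets-empty l xs

packing-count : ∀ n l (xs : List (Subset n)) → AllPairs (Sparse l) xs → lSubsets l xs ≤ n C l
packing-count n zero [] [] = z≤n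
packing-count n zero (_ ∷ []) _ = ≤-refl
packing-count n zero (_ ∷ _ ∷ _) ((() ∷ _) ∷ _)
packing-count zero (suc l) xs _ = ≤-reflexive (lSubsets-empty l xs)
packing-count (suc n) (suc l) xs sparse = begin
  lSubsets (suc l) xs                                         ≡⟨ lSubsets-split l xs ⟩
  lSubsets (suc l) (map tail xs) + lSubsets l (link₀ xs)      ≤⟨ +-mono-≤
    (packing-count n (suc l) (map tail xs) (tails-sparse (suc l) xs sparse))
    (packing-count n l (link₀ xs) (link₀-sparse l xs sparse)) ⟩
  n C suc l + n C l                                           ≡⟨ +-comm (n C suc l) _ ⟩
  n C l + n C suc l                                           ≡⟨ nCk+nC[k+1]≡[n+1]C[k+1] n l ⟩
  suc n C suc l                                               ∎
  where open ≤-Reasoning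

packing-bound : ∀ {n r} l (xs : List (Subset n)) → All (λ p → ∣ p ∣ ≡ r) xs →
  AllPairs (Sparse l) xs → length xs * (r C l) ≤ n C l
packing-bound {n} l xs uniform sparse =
  subst (_≤ n C l) (uniform-count xs uniform) (packing-count n l xs sparse)
  where
  uniform-count : ∀ {r} xs → All (λ p → ∣ p ∣ ≡ r) xs → lSubsets l xs ≡ length xs * (r C l)
  uniform-count [] [] = refl
  uniform-count (p ∷ xs) (refl ∷ rest) = cong (λ m → ∣ p ∣ C l + m) (uniform-count xs rest)

module _ {A : Set} where

  lookup-injective : {xs : List A} → Unique xs → Injective _≡_ _≡_ (lookup xs)
  lookup-injective (_ ∷ _) {zero} {zero} _ = refl
  lookup-injective (x∉xs ∷ _) {zero} {suc j} eq = ⊥-elim (All.lookup x∉xs (∈-lookup j) eq)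
  lookup-injective (x∉xs ∷ _) {suc i} {zero} eq = ⊥-elim (All.lookup x∉xs (∈-lookup i) (sym eq))
  lookup-injective (_ ∷ unique) {suc i} {suc j} eq = cong suc (lookup-injective unique eq)

  ∈-removeAt⁻ : ∀ {x} (xs : List A) j → x ∈ removeAt xs j → x ∈ xs
  ∈-removeAt⁻ (_ ∷ _) zero x∈ = there x∈
  ∈-removeAt⁻ (_ ∷ _) (suc j) (here eq) = here eq
  ∈-removeAt⁻ (_ ∷ xs) (suc j) (there x∈) = there (∈-removeAt⁻ xs j x∈)

  All-removeAt : ∀ {P : A → Set} (xs : List A) j → All P xs → All P (removeAt xs j)
  All-removeAt xs j all = All.tabulate (λ x∈ → All.lookup all (∈-removeAt⁻ xs j x∈))

  Unique-removeAt : (xs : List A) → ∀ j → Unique xs → Unique (removeAt xs j)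
  Unique-removeAt (_ ∷ _) zero (_ ∷ unique) = unique
  Unique-removeAt (_ ∷ xs) (suc j) (x∉xs ∷ unique) =
    All-removeAt xs j x∉xs ∷ Unique-removeAt xs j unique

  lookup∉removeAt : (xs : List A) → ∀ j → Unique xs → lookup xs j ∉ removeAt xs j
  lookup∉removeAt (_ ∷ _) zero (x∉xs ∷ _) x∈ = All.lookup x∉xs x∈ refl
  lookup∉removeAt (_ ∷ _) (suc j) (x∉xs ∷ _) (here eq) = All.lookup x∉xs (∈-lookup j) (sym eq)
  lookup∉removeAt (_ ∷ xs) (suc j) (_ ∷ unique) (there x∈) = lookup∉removeAt xs j unique x∈

∷-injective : ∀ {A : Set} {k} {q : A} {F : Fin k → A} →
  (∀ i → q ≢ F i) → Injective _≡_ _≡_ F → Injective _≡_ _≡_ (q Vector.∷ F)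
∷-injective q∉F F-inj {zero} {zero} _ = refl
∷-injective q∉F F-inj {zero} {suc j} eq = ⊥-elim (q∉F j eq)
∷-injective q∉F F-inj {suc i} {zero} eq = ⊥-elim (q∉F i (sym eq))
∷-injective q∉F F-inj {suc i} {suc j} eq = cong suc (F-inj eq)

⋃[_] : ∀ {n e} → (Fin e → Subset n) → Subset n
⋃[ F ] = ⋃ (tabulate F)

GFree-family : ∀ {r n e v} (H : Hypergraph r n) → GFree v e H →
  (F : Fin e → Subset n) → (∀ i → F i ∈ edges H) → Injective _≡_ _≡_ F →
  v ℤ.+ + 1 ℤ.≤ + ∣ ⋃[ F ] ∣
GFree-family {e = e} {v = v} H free F F∈H F-inj =
  subst (λ xs → v ℤ.+ + 1 ℤ.≤ + ∣ ⋃ xs ∣) (tabulate-cong position-correct)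
    (free position position-injective)
  where
  position : Fin e → Fin (numEdges H)
  position i = index (F∈H i)
  position-correct : ∀ i → lookup (edges H) (position i) ≡ F i
  position-correct i = sym (lookup-index (F∈H i))
  position-injective : Injective _≡_ _≡_ position
  position-injective {i} {j} eq =
    F-inj (trans (sym (position-correct i)) (trans (cong (lookup (edges H)) eq) (position-correct j)))

Violation : ∀ {r n} → ℤ → ℕ → Hypergraph r n → Set
Violation v e H = Σ (Fin e → Fin (numEdges H)) λ idx → Injective _≡_ _≡_ idx ×
  ¬ (v ℤ.+ + 1 ℤ.≤ + ∣ ⋃[ (λ i → lookup (edges H) (idx i)) ] ∣)

free-or-violation : ∀ {r n} v e (H : Hypergraph r n) → DoubleNegation (GFree v e H ⊎ Violation v e H)
free-or-violation v e H neither =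
  neither (inj₁ λ idx idx-inj → decidable-stable (_ ℤP.≤? _) λ few → neither (inj₂ (idx , idx-inj , few)))

-- The arithmetic core of the key lemma: if q (|q| = r) and U span at least
-- (a+r) - R + 1 vertices while U spans at most a - (R-l), they share < l.
few-common : ∀ {a r u w c l} (R : ℤ) → w + c ≡ r + u →
  (+ (r + a) ℤ.- R) ℤ.+ + 1 ℤ.≤ + w → ¬ ((+ a ℤ.- (R ℤ.- + l)) ℤ.+ + 1 ℤ.≤ + u) → c < l
few-common {a} {r} {u} {w} {c} {l} R w+c≡r+u many few = ≰⇒> λ l≤c → few (begin
  (+ a ℤ.- (R ℤ.- + l)) ℤ.+ + 1             ≡⟨ rearrange (+ a) R (+ l) (+ r) ⟩
  ((+ (r + a) ℤ.- R) ℤ.+ + 1 ℤ.+ + l) ℤ.- + r ≤⟨ ℤP.+-monoˡ-≤ (ℤ.- + r) (ℤP.+-monoˡ-≤ (+ l) many) ⟩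
  (+ w ℤ.+ + l) ℤ.- + r                     ≤⟨ ℤP.+-monoˡ-≤ (ℤ.- + r) (ℤP.+-monoʳ-≤ (+ w) (ℤ.+≤+ l≤c)) ⟩
  + (w + c) ℤ.- + r                         ≡⟨ cong (λ z → + z ℤ.- + r) w+c≡r+u ⟩
  + (r + u) ℤ.- + r                         ≡⟨ cancel (+ r) (+ u) ⟩
  + u                                       ∎)
  where
  open ℤP.≤-Reasoning
  open ℤSolver.+-*-Solver
  rearrange : ∀ a R l r → (a ℤ.- (R ℤ.- l)) ℤ.+ + 1 ≡ (((r ℤ.+ a) ℤ.- R) ℤ.+ + 1 ℤ.+ l) ℤ.- r
  rearrange = solve 4 (λ a R l r → (a :- (R :- l)) :+ con (+ 1) := (((r :+ a) :- R) :+ con (+ 1) :+ l) :- r) refl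
  cancel : ∀ r u → (r ℤ.+ u) ℤ.- r ≡ u
  cancel = solve 2 (λ r u → (r :+ u) :- r := u) refl

-- Peeling a G_r(er-R, e)-free hypergraph H, where e = k+2.
module Peeling {r n k : ℕ} (R : ℤ) (l : ℕ) (H : Hypergraph r n)
  (free : GFree (+ (suc (suc k) * r) ℤ.- R) (suc (suc k)) H) where

  E : List (Subset n)
  E = edges H

  v : ℤ
  v = + (suc (suc k) * r) ℤ.- R

  v′ : ℤ
  v′ = + (suc k * r) ℤ.- (R ℤ.- + l)

  sparse-outside : (F : Fin (suc k) → Subset n) → (∀ i → F i ∈ E) → Injective _≡_ _≡_ F →
    ¬ (v′ ℤ.+ + 1 ℤ.≤ + ∣ ⋃[ F ] ∣) → ∀ {q} → q ∈ E → (∀ i → q ≢ F i) → Sparse l (F zero) q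
  sparse-outside F F∈E F-inj few {q} q∈E q∉F =
    ≤-<-trans (∣p∩q∣≤∣q∩[p∪s]∣ (F zero) q ⋃[ (λ i → F (suc i)) ]) q∩U<l
    where
    many : v ℤ.+ + 1 ℤ.≤ + ∣ q ∪ ⋃[ F ] ∣
    many = GFree-family {v = v} H free (q Vector.∷ F)
      (λ { zero → q∈E ; (suc i) → F∈E i }) (∷-injective q∉F F-inj)
    q∩U<l : ∣ q ∩ ⋃[ F ] ∣ < l
    q∩U<l = few-common R
      (trans (inclusion-exclusion q ⋃[ F ]) (cong (_+ ∣ ⋃[ F ] ∣) (All.lookup (uniform H) q∈E)))
      many few

  record State : Set where
    field
      kept            : List (Subset n)
      kept-unique     : Unique kept
      kept-edges      : All (_∈ E) kept
      removed         : List (Subset n)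
      removed-edges   : All (_∈ E) removed
      removed-outside : All (_∉ kept) removed
      removed-sparse  : AllPairs (Sparse l) removed
      accounted       : numEdges H ≤ length kept + length removed
  open State

  keptGraph : State → Hypergraph r n
  keptGraph s = record
    { edges = kept s
    ; unique = kept-unique s
    ; uniform = All.map (All.lookup (uniform H)) (kept-edges s) }

  record Split : Set where
    field
      core            : Hypergraph r n
      core-free       : GFree v′ (suc k) core
      packing         : List (Subset n)
      packing-uniform : All (λ p → ∣ p ∣ ≡ r) packing
      packing-sparse  : AllPairs (Sparse l) packing
      covers          : numEdges H ≤ numEdges core + length packing

  initial : State
  initial = record
    { kept = E ; kept-unique = unique H ; kept-edges = All.tabulate (λ x∈ → x∈)
    ; removed = [] ; removed-edges = [] ; removed-outside = [] ; removed-sparse = []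
    ; accounted = ≤-reflexive (sym (+-identityʳ _)) }

  finish : (s : State) → GFree v′ (suc k) (keptGraph s) → Split
  finish s kept-free = record
    { core = keptGraph s ; core-free = kept-free
    ; packing = removed s
    ; packing-uniform = All.map (All.lookup (uniform H)) (removed-edges s)
    ; packing-sparse = removed-sparse s
    ; covers = accounted s }

  remove : (s : State) → Violation v′ (suc k) (keptGraph s) → State
  remove s (idx , idx-inj , few) = record
    { kept = removeAt (kept s) j
    ; kept-unique = Unique-removeAt (kept s) j (kept-unique s)
    ; kept-edges = All-removeAt (kept s) j (kept-edges s)
    ; removed = p ∷ removed s
    ; removed-edges = kept-edge j ∷ removed-edges s
    ; removed-outside = lookup∉removeAt (kept s) j (kept-unique s)
        ∷ All.map (λ q∉ q∈ → q∉ (∈-removeAt⁻ (kept s) j q∈)) (removed-outside s)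
    ; removed-sparse = All.zipWith p-sparse (removed-edges s , removed-outside s) ∷ removed-sparse s
    ; accounted = subst (numEdges H ≤_) shrink (accounted s) }
    where
    j : Fin (length (kept s))
    j = idx zero
    p : Subset n
    p = lookup (kept s) j
    kept-edge : ∀ i → lookup (kept s) i ∈ E
    kept-edge i = All.lookup (kept-edges s) (∈-lookup i)
    p-sparse : ∀ {q} → q ∈ E × q ∉ kept s → Sparse l p q
    p-sparse (q∈E , q∉kept) =
      sparse-outside (λ i → lookup (kept s) (idx i)) (λ i → kept-edge (idx i))
        (λ eq → idx-inj (lookup-injective (kept-unique s) eq)) few q∈E
        (λ i q≡ → q∉kept (subst (_∈ kept s) (sym q≡) (∈-lookup (idx i))))
    shrink : length (kept s) + length (removed s) ≡ length (removeAt (kept s) j) + suc (length (removed s))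
    shrink = trans (cong (_+ length (removed s)) (length-removeAt′ (kept s) j)) (sym (+-suc _ _))

  -- Iterate the step; t bounds the number of kept edges, hence of steps.
  peel : ∀ t (s : State) → length (kept s) ≡ t → DoubleNegation Split
  peel t s size not-split = free-or-violation v′ (suc k) (keptGraph s) λ
    { (inj₁ kept-free) → not-split (finish s kept-free)
    ; (inj₂ bad) → step t bad size not-split }
    where
    step : ∀ t → Violation v′ (suc k) (keptGraph s) → length (kept s) ≡ t → DoubleNegation Split
    step zero (idx , _) size = ⊥-elim (no-position (subst Fin size (idx zero)))
      where
      no-position : Fin 0 → ⊥
      no-position ()
    step (suc t) bad@(idx , _) size =
      peel t (remove s bad) (suc-injective (trans (sym (length-removeAt′ (kept s) (idx zero))) size))

  split : DoubleNegation Split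
  split = peel (length E) initial refl

-- The theorem: the kept edges number at most T₂ by maximality of T₂, the
-- removed ones at most C(n,l)/C(r,l) by the packing bound.
theorem20 : (n r e : ℕ) (R : ℤ) → 2 ≤ e → (l : ℕ) → 1 ≤ l → l ≤ r →
    (T₁ T₂ : ℕ) → IsT r n R e T₁ → IsT r n (R ℤ.- + l) (e ∸ 1) T₂ →
    T₁ * (r C l) ≤ T₂ * (r C l) + n C l
theorem20 n r zero R () l
theorem20 n r (suc zero) R (s≤s ()) l
theorem20 n r (suc (suc k)) R _ l _ _ _ T₂ ((H , free , refl) , _) (_ , maximal) =
  decidable-stable (_ ℕ.≤? _) (¬¬-map bound split)
  where
  open Peeling R l H free
  bound : Split → numEdges H * (r C l) ≤ T₂ * (r C l) + n C l
  bound s = begin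
    numEdges H * (r C l)                                   ≤⟨ *-monoˡ-≤ (r C l) covers ⟩
    (numEdges core + length packing) * (r C l)             ≡⟨ *-distribʳ-+ (r C l) (numEdges core) _ ⟩
    numEdges core * (r C l) + length packing * (r C l)     ≤⟨ +-mono-≤
      (*-monoˡ-≤ (r C l) (maximal core core-free))
      (packing-bound l packing packing-uniform packing-sparse) ⟩
    T₂ * (r C l) + n C l                                   ∎
    where
    open Split s
    open ≤-Reasoning
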